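{- Let $n=2^k-1$ and let $C\subseteq F^n$ be a homogeneous binary perfect code containing $0^n$. Then the Vasil'ev code $V_C^0 = \{(x+y, |x|, x) : x\in F^n, y\in C\}$ of length $2n+1$ (the Vasil'ev construction with $\lambda \equiv 0$) is homogeneous.
   Context: $F^n$ is the binary Hamming space; $|x| = x_1+\dots+x_n \pmod 2$. A code $C\subseteq F^n$ is perfect if every vector of $F^n$ is at distance at most one from exactly one codeword. For $y \in C$, $\mathrm{STS}(C,y) = \{\mathrm{supp}(x+y) : x \in C, d(x,y)=3\}$. $C$ is homogeneous if for every $y\in C$ there is a coordinate permutation $\pi$ with $\pi(\mathrm{STS}(C,y)) = \mathrm{STS}(C,0^n)$. -}

module Defs where

open import Data.Bool using (Bool; true; false; _xor_)
open import Data.Nat using (ℕ; zero; suc; _+_; _≤_)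
open import Data.Fin using (Fin)
open import Data.Fin.Permutation using (Permutation′; _⟨$⟩ʳ_; _⟨$⟩ˡ_)
open import Data.Vec using (Vec; []; _∷_; zipWith; replicate; tabulate; lookup; _++_; [_])
open import Data.Product using (Σ; _×_; ∃)
open import Relation.Binary.PropositionalEquality using (_≡_)

-- Binary words of length n (elements of F^n); a subset of coordinates
-- (a support) is likewise represented by its characteristic vector.
Word : ℕ → Set
Word n = Vec Bool n

Code : ℕ → Set₁
Code n = Word n → Set

_⊕_ : ∀ {n} → Word n → Word n → Word n
_⊕_ = zipWith _xor_

zeroW : ∀ n → Word n
zeroW n = replicate n false

wt : ∀ {n} → Word n → ℕ
wt [] = 0
wt (true ∷ v) = suc (wt v)
wt (false ∷ v) = wt v

dist : ∀ {n} → Word n → Word n → ℕ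
dist x y = wt (x ⊕ y)

-- |x| = x_1 + ... + x_n mod 2
parity : ∀ {n} → Word n → Bool
parity [] = false
parity (b ∷ v) = b xor parity v

IsPerfect : ∀ {n} → Code n → Set
IsPerfect {n} C =
  (v : Word n) → Σ (Word n) λ c → C c × dist v c ≤ 1 ×
    ((c′ : Word n) → C c′ → dist v c′ ≤ 1 → c′ ≡ c)

InSTS : ∀ {n} → Code n → Word n → Word n → Set
InSTS {n} C y s = Σ (Word n) λ x → C x × dist x y ≡ 3 × s ≡ x ⊕ y

-- action of a coordinate permutation π on a word / support:
-- coordinate i of w becomes coordinate π(i) of (permute π w)
permute : ∀ {n} → Permutation′ n → Word n → Word n
permute π w = tabulate λ j → lookup w (π ⟨$⟩ˡ j)

IsHomogeneous : ∀ {n} → Code n → Set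
IsHomogeneous {n} C =
  (y : Word n) → C y → Σ (Permutation′ n) λ π →
    ((t : Word n) →
      (Σ (Word n) λ s → InSTS C y s × permute π s ≡ t) → InSTS C (zeroW n) t)
    × ((t : Word n) →
      InSTS C (zeroW n) t → Σ (Word n) λ s → InSTS C y s × permute π s ≡ t)

Vasilev0 : ∀ {n} → Code n → Code (n + suc n)
Vasilev0 {n} C w =
  Σ (Word n) λ x → Σ (Word n) λ y → C y × w ≡ (x ⊕ y) ++ (parity x ∷ x)

-- Write  shape u c = (u + c, |u|, u), so that V = V_C^0 = { shape x y : y ∈ C }.
-- The map shape is linear, hence for  z = shape a b ∈ V  the neighbours of z
-- at distance 3 are exactly the words  s = shape u (y + b)  of weight 3 with
-- y ∈ C.  Since wt (y + b) ≤ wt s = 3 and a perfect code has minimum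
-- distance 3, either y = b or y + b ∈ STS(C,b).  If π carries STS(C,b) onto
-- STS(C,0) (homogeneity of C at b), then the coordinate permutation
-- Π = π ⊎ lift₀ π of F^(2n+1), acting blockwise, maps shape u c to
-- shape (π u) (π c); it preserves weight, and π c ∈ C, so it carries
-- STS(V,z) into STS(V,0); the converse inclusion uses π⁻¹ in the same way.

module Submission where

open import Defs
open import Level using (Level; 0ℓ)
open import Data.Nat using (ℕ; _^_; _∸_)
open import Data.Nat.Base using (zero; suc; _+_; _≤_; z≤n; s≤s; pred)
open import Data.Nat.Properties
  using (≤-refl; ≤-trans; ≤-reflexive; +-suc; n≤1+n; m≤n⇒m≤1+n; +-monoʳ-≤;
         pred-mono-≤; m≤n⇒m<n∨m≡n; +-0-commutativeMonoid; module ≤-Reasoning)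
open import Data.Bool using (Bool; true; false; _xor_)
open import Data.Bool.Properties
  using (xor-assoc; xor-comm; xor-identityʳ; xor-same; xor-∧-commutativeRing)
open import Data.Fin using (Fin; zero; suc; _↑ˡ_; _↑ʳ_; splitAt; join)
open import Data.Fin.Properties using (+↔⊎; splitAt-↑ˡ; splitAt-↑ʳ)
open import Data.Fin.Permutation
  using (Permutation′; _⟨$⟩ˡ_; flip; inverseʳ; lift₀)
open import Data.Vec using ([]; _∷_; zipWith; tabulate; lookup; _++_)
open import Data.Vec.Properties
  using (zipWith-assoc; zipWith-comm; zipWith-identityʳ; zipWith-++;
         lookup-zipWith; lookup-++ˡ; lookup-++ʳ; lookup∘tabulate; tabulate∘lookup;
         tabulate-cong)
open import Data.Product using (Σ; _×_; _,_; proj₁; proj₂)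
open import Data.Sum using (_⊎_; inj₁; inj₂) renaming (map to ⊎-map)
open import Data.Sum.Function.Propositional using (_⊎-↔_)
open import Function using (_∘_)
open import Function.Properties.Inverse using (↔-trans; ↔-sym)
open import Algebra.Bundles using (CommutativeMonoid; CommutativeRing)
import Algebra.Properties.CommutativeSemigroup as CommutativeSemigroupProperties
import Algebra.Properties.CommutativeMonoid.Sum as SumProperties
open import Relation.Binary.PropositionalEquality
  using (_≡_; refl; sym; trans; cong; cong₂; subst; subst₂; module ≡-Reasoning)

private
  variable
    m k n : ℕ

-- (Bool, xor, false) as a commutative monoid: the parity of a word is its
-- sum there, just as its weight is the sum of its bits in (ℕ, +, 0).
xor-commutativeMonoid : CommutativeMonoid 0ℓ 0ℓ
xor-commutativeMonoid = CommutativeRing.+-commutativeMonoid xor-∧-commutativeRing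

xor-interchange : ∀ a b c d → (a xor b) xor (c xor d) ≡ (a xor c) xor (b xor d)
xor-interchange = CommutativeSemigroupProperties.interchange
  (CommutativeMonoid.commutativeSemigroup xor-commutativeMonoid)

⊕-assoc : (x y z : Word n) → (x ⊕ y) ⊕ z ≡ x ⊕ (y ⊕ z)
⊕-assoc = zipWith-assoc xor-assoc

⊕-comm : (x y : Word n) → x ⊕ y ≡ y ⊕ x
⊕-comm = zipWith-comm xor-comm

⊕-identityʳ : (x : Word n) → x ⊕ zeroW n ≡ x
⊕-identityʳ = zipWith-identityʳ xor-identityʳ

⊕-self : (x : Word n) → x ⊕ x ≡ zeroW n
⊕-self [] = refl
⊕-self (b ∷ x) = cong₂ _∷_ (xor-same b) (⊕-self x)

⊕-cancelʳ : (x y : Word n) → (x ⊕ y) ⊕ y ≡ x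
⊕-cancelʳ {n} x y = begin
  (x ⊕ y) ⊕ y   ≡⟨ ⊕-assoc x y y ⟩
  x ⊕ (y ⊕ y)   ≡⟨ cong (x ⊕_) (⊕-self y) ⟩
  x ⊕ zeroW n   ≡⟨ ⊕-identityʳ x ⟩
  x             ∎
  where open ≡-Reasoning

⊕-interchange : (x y a b : Word n) → (x ⊕ y) ⊕ (a ⊕ b) ≡ (x ⊕ a) ⊕ (y ⊕ b)
⊕-interchange [] [] [] [] = refl
⊕-interchange (x ∷ xs) (y ∷ ys) (a ∷ as) (b ∷ bs) =
  cong₂ _∷_ (xor-interchange x y a b) (⊕-interchange xs ys as bs)

zeroW-++ : ∀ m k → zeroW (m + k) ≡ zeroW m ++ zeroW k
zeroW-++ zero k = refl
zeroW-++ (suc m) k = cong (false ∷_) (zeroW-++ m k)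

wt-⊕-≤ : (x y : Word n) → wt (x ⊕ y) ≤ wt x + wt y
wt-⊕-≤ [] [] = z≤n
wt-⊕-≤ (false ∷ x) (false ∷ y) = wt-⊕-≤ x y
wt-⊕-≤ (true ∷ x) (false ∷ y) = s≤s (wt-⊕-≤ x y)
wt-⊕-≤ (false ∷ x) (true ∷ y) =
  ≤-trans (s≤s (wt-⊕-≤ x y)) (≤-reflexive (sym (+-suc (wt x) (wt y))))
wt-⊕-≤ (true ∷ x) (true ∷ y) =
  m≤n⇒m≤1+n (≤-trans (wt-⊕-≤ x y) (+-monoʳ-≤ (wt x) (n≤1+n (wt y))))

wt-++ : (p : Word m) (q : Word k) → wt (p ++ q) ≡ wt p + wt q
wt-++ [] q = refl
wt-++ (true ∷ p) q = cong suc (wt-++ p q)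
wt-++ (false ∷ p) q = wt-++ p q

wt-∷-≥ : (b : Bool) (x : Word n) → wt x ≤ wt (b ∷ x)
wt-∷-≥ true x = n≤1+n (wt x)
wt-∷-≥ false x = ≤-refl

wt-self : (x : Word n) → wt (x ⊕ x) ≡ 0
wt-self {n} x = trans (cong wt (⊕-self x)) (wt-zeroW n)
  where
  wt-zeroW : ∀ n → wt (zeroW n) ≡ 0
  wt-zeroW zero = refl
  wt-zeroW (suc n) = wt-zeroW n

parity-⊕ : (x y : Word n) → parity (x ⊕ y) ≡ parity x xor parity y
parity-⊕ [] [] = refl
parity-⊕ (x ∷ xs) (y ∷ ys) =
  trans (cong ((x xor y) xor_) (parity-⊕ xs ys))
        (xor-interchange x y (parity xs) (parity ys))

parity-zeroW : ∀ n → parity (zeroW n) ≡ false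
parity-zeroW zero = refl
parity-zeroW (suc n) = parity-zeroW n

module _ {c ℓ : Level} (M : CommutativeMonoid c ℓ) where
  open CommutativeMonoid M using (Carrier; _≈_)
    renaming (reflexive to ≈-reflexive; sym to ≈-sym; trans to ≈-trans)
  open SumProperties M using (sum; sum-cong-≗; sum-permute)

  statistic : (Bool → Carrier) → Word n → Carrier
  statistic h w = sum (λ i → h (lookup w i))

  statistic-permute : (h : Bool → Carrier) (π : Permutation′ n) (w : Word n) →
    statistic h (permute π w) ≈ statistic h w
  statistic-permute h π w = ≈-trans
    (≈-reflexive (sum-cong-≗ (λ j → cong h (lookup∘tabulate (lookup w ∘ (π ⟨$⟩ˡ_)) j))))
    (≈-sym (sum-permute (h ∘ lookup w) (flip π)))

indicator : Bool → ℕ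
indicator true = 1
indicator false = 0

wt-statistic : (w : Word n) → wt w ≡ statistic +-0-commutativeMonoid indicator w
wt-statistic [] = refl
wt-statistic (true ∷ w) = cong suc (wt-statistic w)
wt-statistic (false ∷ w) = wt-statistic w

parity-statistic : (w : Word n) → parity w ≡ statistic xor-commutativeMonoid (λ b → b) w
parity-statistic [] = refl
parity-statistic (b ∷ w) = cong (b xor_) (parity-statistic w)

wt-permute : (π : Permutation′ n) (w : Word n) → wt (permute π w) ≡ wt w
wt-permute π w = trans (wt-statistic (permute π w))
  (trans (statistic-permute +-0-commutativeMonoid indicator π w) (sym (wt-statistic w)))

parity-permute : (π : Permutation′ n) (w : Word n) → parity (permute π w) ≡ parity w
parity-permute π w = trans (parity-statistic (permute π w))
  (trans (statistic-permute xor-commutativeMonoid (λ b → b) π w)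
         (sym (parity-statistic w)))

zipWith-tabulate : {A B C : Set} (f : A → B → C) (g : Fin n → A) (h : Fin n → B) →
  zipWith f (tabulate g) (tabulate h) ≡ tabulate (λ i → f (g i) (h i))
zipWith-tabulate {zero} f g h = refl
zipWith-tabulate {suc n} f g h = cong (f (g zero) (h zero) ∷_) (zipWith-tabulate f (g ∘ suc) (h ∘ suc))

permute-⊕ : (π : Permutation′ n) (a b : Word n) → permute π (a ⊕ b) ≡ permute π a ⊕ permute π b
permute-⊕ π a b = trans
  (tabulate-cong (λ j → lookup-zipWith _xor_ (π ⟨$⟩ˡ j) a b))
  (sym (zipWith-tabulate _xor_ (lookup a ∘ (π ⟨$⟩ˡ_)) (lookup b ∘ (π ⟨$⟩ˡ_))))

permute-self : (π : Permutation′ n) (x : Word n) → permute π (x ⊕ x) ≡ zeroW n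
permute-self π x = trans (permute-⊕ π x x) (⊕-self (permute π x))

permute-flip : (π : Permutation′ n) (x : Word n) → permute π (permute (flip π) x) ≡ x
permute-flip π x = trans
  (tabulate-cong (λ j → trans (lookup∘tabulate _ (π ⟨$⟩ˡ j)) (cong (lookup x) (inverseʳ π))))
  (tabulate∘lookup x)

tabulate-++ : {A : Set} (m k : ℕ) (h : Fin (m + k) → A) →
  tabulate h ≡ tabulate (h ∘ (_↑ˡ k)) ++ tabulate (h ∘ (m ↑ʳ_))
tabulate-++ zero k h = refl
tabulate-++ (suc m) k h = cong (h zero ∷_) (tabulate-++ m k (h ∘ suc))

_⊎ₚ_ : Permutation′ m → Permutation′ k → Permutation′ (m + k)
σ ⊎ₚ τ = ↔-trans +↔⊎ (↔-trans (σ ⊎-↔ τ) (↔-sym +↔⊎))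

permute-⊎ₚ : (σ : Permutation′ m) (τ : Permutation′ k) (p : Word m) (q : Word k) →
  permute (σ ⊎ₚ τ) (p ++ q) ≡ permute σ p ++ permute τ q
permute-⊎ₚ {m} {k} σ τ p q =
  trans (tabulate-++ m k _) (cong₂ _++_ (tabulate-cong onLeft) (tabulate-cong onRight))
  where
  lookupVia : Fin m ⊎ Fin k → Bool
  lookupVia s = lookup (p ++ q) (join m k (⊎-map (σ ⟨$⟩ˡ_) (τ ⟨$⟩ˡ_) s))

  onLeft : ∀ i → lookupVia (splitAt m (i ↑ˡ k)) ≡ lookup p (σ ⟨$⟩ˡ i)
  onLeft i = trans (cong lookupVia (splitAt-↑ˡ m i k)) (lookup-++ˡ p q (σ ⟨$⟩ˡ i))

  onRight : ∀ i → lookupVia (splitAt m (m ↑ʳ i)) ≡ lookup q (τ ⟨$⟩ˡ i)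
  onRight i = trans (cong lookupVia (splitAt-↑ʳ m k i)) (lookup-++ʳ p q (τ ⟨$⟩ˡ i))

blockPerm : Permutation′ n → Permutation′ (n + suc n)
blockPerm π = π ⊎ₚ lift₀ π

permute-blockPerm : (π : Permutation′ n) (p : Word n) (b : Bool) (q : Word n) →
  permute (blockPerm π) (p ++ (b ∷ q)) ≡ permute π p ++ (b ∷ permute π q)
permute-blockPerm π p b q = permute-⊎ₚ π (lift₀ π) p (b ∷ q)

stepTowards : Word n → Word n → Word n
stepTowards [] [] = []
stepTowards (true ∷ y) (true ∷ b) = true ∷ stepTowards y b
stepTowards (false ∷ y) (false ∷ b) = false ∷ stepTowards y b
stepTowards (true ∷ y) (false ∷ b) = false ∷ y
stepTowards (false ∷ y) (true ∷ b) = true ∷ y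

stepTowards-near-start : (y b : Word n) → dist (stepTowards y b) y ≤ 1
stepTowards-near-start [] [] = z≤n
stepTowards-near-start (true ∷ y) (true ∷ b) = stepTowards-near-start y b
stepTowards-near-start (false ∷ y) (false ∷ b) = stepTowards-near-start y b
stepTowards-near-start (true ∷ y) (false ∷ b) = s≤s (≤-reflexive (wt-self y))
stepTowards-near-start (false ∷ y) (true ∷ b) = s≤s (≤-reflexive (wt-self y))

stepTowards-closer : (y b : Word n) → dist (stepTowards y b) b ≤ pred (dist y b)
stepTowards-closer [] [] = z≤n
stepTowards-closer (true ∷ y) (true ∷ b) = stepTowards-closer y b
stepTowards-closer (false ∷ y) (false ∷ b) = stepTowards-closer y b
stepTowards-closer (true ∷ y) (false ∷ b) = ≤-refl
stepTowards-closer (false ∷ y) (true ∷ b) = ≤-refl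

-- codewords at distance ≤ 2 are equal: a step from y towards b is within
-- distance 1 of both, and the codeword covering it is unique
perfect-min-distance : {C : Code n} → IsPerfect C → ∀ {y b} → C y → C b →
  dist y b ≤ 2 → y ≡ b
perfect-min-distance perfect {y} {b} Cy Cb d≤2
  with perfect (stepTowards y b)
... | _ , _ , _ , unique = trans
  (unique y Cy (stepTowards-near-start y b))
  (sym (unique b Cb (≤-trans (stepTowards-closer y b) (pred-mono-≤ d≤2))))

close-codewords : {C : Code n} → IsPerfect C → ∀ {y b} → C y → C b →
  dist y b ≤ 3 → y ≡ b ⊎ dist y b ≡ 3
close-codewords perfect Cy Cb d≤3 with m≤n⇒m<n∨m≡n d≤3
... | inj₁ (s≤s d≤2) = inj₁ (perfect-min-distance perfect Cy Cb d≤2)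
... | inj₂ d≡3 = inj₂ d≡3

MapsSTS : Code n → Word n → Permutation′ n → Set
MapsSTS {n} C y π =
  ((t : Word n) →
    (Σ (Word n) λ s → InSTS C y s × permute π s ≡ t) → InSTS C (zeroW n) t)
  × ((t : Word n) →
    InSTS C (zeroW n) t → Σ (Word n) λ s → InSTS C y s × permute π s ≡ t)

-- Together with the trivial difference 0, STS(C,b) is {y + b : y ∈ C, d(y,b) ≤ 3}
-- and STS(C,0) ∪ {0} is {y ∈ C : wt y ≤ 3}; π matches the two sets.
module HomogeneousAt {C : Code n} (perfect : IsPerfect C) (C0 : C (zeroW n))
  {b : Word n} (Cb : C b) {π : Permutation′ n} (maps : MapsSTS C b π) where

  push-near : {y : Word n} → C y → dist y b ≤ 3 → C (permute π (y ⊕ b))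
  push-near {y} Cy d≤3 with close-codewords perfect Cy Cb d≤3
  ... | inj₁ refl = subst C (sym (permute-self π b)) C0
  ... | inj₂ d≡3 with proj₁ maps (permute π (y ⊕ b)) (y ⊕ b , (y , Cy , d≡3 , refl) , refl)
  ...   | x , Cx , _ , t≡x⊕0 = subst C (sym (trans t≡x⊕0 (⊕-identityʳ x))) Cx

  pull-near : {y : Word n} → C y → dist y (zeroW n) ≤ 3 →
    Σ (Word n) λ e → C e × permute π (e ⊕ b) ≡ y
  pull-near {y} Cy d≤3 with close-codewords perfect Cy C0 d≤3
  ... | inj₁ refl = b , Cb , permute-self π b
  ... | inj₂ d≡3 with proj₂ maps y (y , Cy , d≡3 , sym (⊕-identityʳ y))
  ...   | s , (e , Ce , _ , s≡e⊕b) , πs≡y = e , Ce , trans (cong (permute π) (sym s≡e⊕b)) πs≡y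

shape : Word n → Word n → Word (n + suc n)
shape u c = (u ⊕ c) ++ (parity u ∷ u)

-- shape is linear, since parity is
shape-⊕ : (x y a b : Word n) → shape x y ⊕ shape a b ≡ shape (x ⊕ a) (y ⊕ b)
shape-⊕ x y a b = trans
  (zipWith-++ _xor_ (x ⊕ y) (parity x ∷ x) (a ⊕ b) (parity a ∷ a))
  (cong₂ (λ p m → p ++ (m ∷ (x ⊕ a))) (⊕-interchange x y a b) (sym (parity-⊕ x a)))

shape-zero : ∀ n → shape (zeroW n) (zeroW n) ≡ zeroW (n + suc n)
shape-zero n = trans
  (cong₂ (λ p m → p ++ (m ∷ zeroW n)) (⊕-identityʳ (zeroW n)) (parity-zeroW n))
  (sym (zeroW-++ n (suc n)))

permute-shape : (π : Permutation′ n) (u c : Word n) →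
  permute (blockPerm π) (shape u c) ≡ shape (permute π u) (permute π c)
permute-shape π u c = trans
  (permute-blockPerm π (u ⊕ c) (parity u) u)
  (cong₂ (λ p m → p ++ (m ∷ permute π u)) (permute-⊕ π u c) (sym (parity-permute π u)))

-- c = (u + c) + u, so the code part never outweighs the whole word
wt-shape-≥ : (u c : Word n) → wt c ≤ wt (shape u c)
wt-shape-≥ u c = begin
  wt c                             ≡⟨ cong wt c≡ ⟨
  wt ((u ⊕ c) ⊕ u)                 ≤⟨ wt-⊕-≤ (u ⊕ c) u ⟩
  wt (u ⊕ c) + wt u                ≤⟨ +-monoʳ-≤ (wt (u ⊕ c)) (wt-∷-≥ (parity u) u) ⟩
  wt (u ⊕ c) + wt (parity u ∷ u)   ≡⟨ wt-++ (u ⊕ c) (parity u ∷ u) ⟨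
  wt (shape u c)                   ∎
  where
  open ≤-Reasoning
  c≡ : (u ⊕ c) ⊕ u ≡ c
  c≡ = trans (cong (_⊕ u) (⊕-comm u c)) (⊕-cancelʳ c u)

module _ {C : Code n} where

  sts-vasilev-shape : {a b : Word n} {s : Word (n + suc n)} → InSTS (Vasilev0 C) (shape a b) s →
    wt s ≡ 3 × Σ (Word n) λ u → Σ (Word n) λ y → C y × s ≡ shape u (y ⊕ b)
  sts-vasilev-shape {a} {b} (w , (x , y , Cy , refl) , d≡3 , s≡) =
    trans (cong wt s≡) d≡3 , x ⊕ a , y , Cy , trans s≡ (shape-⊕ x y a b)

  shape-in-sts-vasilev : {a b u y c : Word n} → C y → c ≡ y ⊕ b → wt (shape u c) ≡ 3 →
    InSTS (Vasilev0 C) (shape a b) (shape u c)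
  shape-in-sts-vasilev {a} {b} {u} {y} Cy refl wt≡3 =
    shape (u ⊕ a) y , (u ⊕ a , y , Cy , refl) , trans (cong wt sum≡) wt≡3 , sym sum≡
    where
    sum≡ : shape (u ⊕ a) y ⊕ shape a b ≡ shape u (y ⊕ b)
    sum≡ = trans (shape-⊕ (u ⊕ a) y a b) (cong (λ v → shape v (y ⊕ b)) (⊕-cancelʳ u a))

-- If π witnesses homogeneity of C at b, then blockPerm π witnesses
-- homogeneity of V_C^0 at every shape a b; this holds for every length n.
vasilev-homogeneous : {C : Code n} → IsPerfect C → C (zeroW n) → IsHomogeneous C →
  IsHomogeneous (Vasilev0 C)
vasilev-homogeneous {n} {C} perfect C0 homogeneous z (a , b , Cb , refl)
  with homogeneous b Cb
... | π , maps = blockPerm π , forward , backward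
  where
  open HomogeneousAt {C = C} perfect C0 {b} Cb {π} maps
  V : Code (n + suc n)
  V = Vasilev0 C
  Π : Permutation′ (n + suc n)
  Π = blockPerm π

  -- Π (shape u (y + b)) = shape (π u) (π (y + b)), a weight-3 neighbour of 0
  forward : (t : Word (n + suc n)) →
    (Σ (Word (n + suc n)) λ s → InSTS V (shape a b) s × permute Π s ≡ t) →
    InSTS V (zeroW (n + suc n)) t
  forward t (s , s∈ , Πs≡t) with sts-vasilev-shape s∈
  ... | wt≡3 , u , y , Cy , refl =
    subst₂ (InSTS V) (shape-zero n) image≡t
      (shape-in-sts-vasilev (push-near Cy near) (sym (⊕-identityʳ _)) wt-image)
    where
    near : dist y b ≤ 3
    near = subst (wt (y ⊕ b) ≤_) wt≡3 (wt-shape-≥ u (y ⊕ b))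
    image≡t : shape (permute π u) (permute π (y ⊕ b)) ≡ t
    image≡t = trans (sym (permute-shape π u (y ⊕ b))) Πs≡t
    wt-image : wt (shape (permute π u) (permute π (y ⊕ b))) ≡ 3
    wt-image = trans (cong wt (sym (permute-shape π u (y ⊕ b))))
                     (trans (wt-permute Π (shape u (y ⊕ b))) wt≡3)

  -- t = shape x y is the image of shape (π⁻¹ x) (e + b), where π (e + b) = y
  backward : (t : Word (n + suc n)) → InSTS V (zeroW (n + suc n)) t →
    Σ (Word (n + suc n)) λ s → InSTS V (shape a b) s × permute Π s ≡ t
  backward t t∈ with sts-vasilev-shape (subst (λ z → InSTS V z t) (sym (shape-zero n)) t∈)
  ... | wt≡3 , x , y , Cy , refl
    with pull-near Cy (subst (dist y (zeroW n) ≤_) wt≡3 (wt-shape-≥ x (y ⊕ zeroW n)))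
  ...   | e , Ce , π[e⊕b]≡y = s , shape-in-sts-vasilev Ce refl wt-s , Πs≡t
    where
    s : Word (n + suc n)
    s = shape (permute (flip π) x) (e ⊕ b)
    Πs≡t : permute Π s ≡ shape x (y ⊕ zeroW n)
    Πs≡t = trans (permute-shape π (permute (flip π) x) (e ⊕ b))
      (cong₂ shape (permute-flip π x) (trans π[e⊕b]≡y (sym (⊕-identityʳ y))))
    wt-s : wt s ≡ 3
    wt-s = trans (sym (wt-permute Π s)) (trans (cong wt Πs≡t) wt≡3)

mainTheorem4 : (k : ℕ) (C : Code (2 ^ k ∸ 1)) →
    IsPerfect C → C (zeroW (2 ^ k ∸ 1)) → IsHomogeneous C →
    IsHomogeneous (Vasilev0 C)
mainTheorem4 k C = vasilev-homogeneous
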